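{- Let $f$ be a compositional syntactic measure. If Duplicator has a winning strategy in the game $\mathrm{SG}(r,k,f)$ on $(\mathscr{A},\mathscr{B})$, then the oblivious strategy is a winning strategy for Duplicator.
   Context: $\tau$ has finitely many relation and constant symbols, equality treated as a binary predicate; $\mathrm{FO}^k(\tau)$ is the set of first-order formulas over $\tau$ using only variables $x_1,\dots,x_k$. A compositional syntactic measure is $f:\mathrm{FO}^k(\tau)\to\mathbb{N}$ determined by functions $h_\neg,h_\exists,h_\forall:\mathbb{N}\to\mathbb{N}$, $h_\vee,h_\wedge:\mathbb{N}^2\to\mathbb{N}$, $h_{\mathsf{atomic}}$ on predicate symbols, via $f(P(\dots))=h_{\mathsf{atomic}}(P)$, $f(\neg\psi)=h_\neg(f(\psi))$, $f(\psi\vee\gamma)=h_\vee(f(\psi),f(\gamma))$, $f(\psi\wedge\gamma)=h_\wedge(f(\psi),f(\gamma))$, $f(\exists x\psi)=h_\exists(f(\psi))$, $f(\forall x\psi)=h_\forall(f(\psi))$. A structure-assignment pair $(\mathbf{A},\alpha)$ is a $\tau$-structure with a partial map from variables to its universe; $\mathscr{A},\mathscr{B}$ are domain-consistent sets of such pairs (all assignments share a domain, contained in $\{x_1,\dots,x_k\}$). A separating formula for $(\mathscr{A}',\mathscr{B}')$ has free variables in the common domain, holds in all pairs of $\mathscr{A}'$ and fails in all pairs of $\mathscr{B}'$. The game $\mathrm{SG}(r,k,f)$: a tree of nodes $(\mathscr{A}',\mathscr{B}',r')$, root $(\mathscr{A},\mathscr{B},r)$. On an open leaf Spoiler may: Pebble-Left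 (if $h_\exists^{ -1}(r')\ne\emptyset$): choose $x_i$, (re)assign $x_i$ in each pair of $\mathscr{A}'$; Duplicator, for each pair of $\mathscr{B}'$, may make any number of copies and (re)assigns $x_i$ in each copy; Spoiler picks $r''$ with $h_\exists(r'')=r'$; child with counter $r''$. Pebble-Right: dual with $h_\forall$. Split-Left (if $h_\vee^{ -1}(r')\ne\emptyset$): partition $\mathscr{A}'$ into two parts and pick $r'_1,r'_2$ with $h_\vee(r'_1,r'_2)=r'$, giving two children. Split-Right: dual with $h_\wedge$, partitioning $\mathscr{B}'$. Swap (if $h_\neg^{ -1}(r')\ne\emptyset$): child $(\mathscr{B}',\mathscr{A}',r'')$ with $h_\neg(r'')=r'$. Close: if an atomic formula $\varphi$ separates $(\mathscr{A}',\mathscr{B}')$ and $h_{\mathsf{atomic}}$ of its predicate is $r'$, the leaf is closed. Spoiler wins iff all leaves get closed. Duplicator's oblivious strategy: whenever she responds, for each pair on her side she makes one copy for each element of its universe and assigns the variable to a different element in each copy. -}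

module Defs where

open import Data.Nat using (ℕ; zero; suc)
open import Data.Fin using (Fin; zero; suc)
open import Data.Fin.Properties using (_≟_)
open import Data.Bool using (Bool; true; false; if_then_else_)
open import Data.Maybe using (Maybe; just; nothing; is-just)
open import Data.Sum using (_⊎_; inj₁; inj₂)
open import Data.Product using (Σ; _×_; _,_; proj₁; proj₂)
open import Data.List using (List; []; _∷_; _++_; allFin)
import Data.List as List
open import Data.List.NonEmpty using (List⁺; _∷_)
import Data.List.NonEmpty as List⁺
open import Data.List.Relation.Unary.All using (All)
import Data.List.Relation.Unary.All as All
open import Relation.Nullary.Decidable using (⌊_⌋)
open import Relation.Binary.PropositionalEquality using (_≡_)

record Sig : Set where
  field
    nRel   : ℕ
    arity  : Fin nRel → ℕ
    nConst : ℕ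
open Sig public

data PredSym (τ : Sig) : Set where
  rel : Fin (nRel τ) → PredSym τ
  eq  : PredSym τ

predArity : {τ : Sig} → PredSym τ → ℕ
predArity {τ} (rel R) = arity τ R
predArity eq          = 2

record Structure (τ : Sig) (n : ℕ) : Set where
  field
    relI   : (R : Fin (nRel τ)) → (Fin (arity τ R) → Fin (suc n)) → Bool
    constI : Fin (nConst τ) → Fin (suc n)
open Structure public

-- Compositional syntactic measures, given by their h-functions.

record CSM (τ : Sig) : Set where
  field
    h¬     : ℕ → ℕ
    h∃     : ℕ → ℕ
    h∀     : ℕ → ℕ
    h∨     : ℕ → ℕ → ℕ
    h∧     : ℕ → ℕ → ℕ
    hatom  : PredSym τ → ℕ
open CSM public

module Game (τ : Sig) (k : ℕ) (f : CSM τ) where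

  Pair : Set
  Pair = Σ ℕ λ n → Structure τ n × (Fin k → Maybe (Fin (suc n)))

  Elem : Pair → Set
  Elem p = Fin (suc (proj₁ p))

  Term : Set
  Term = Fin k ⊎ Fin (nConst τ)

  record Atom : Set where
    constructor atom
    field
      pred : PredSym τ
      args : Fin (predArity pred) → Term
  open Atom public

  evalTerm : (p : Pair) → Term → Maybe (Elem p)
  evalTerm (n , A , α) (inj₁ i) = α i
  evalTerm (n , A , α) (inj₂ c) = just (constI A c)

  allJust : {X : Set} (m : ℕ) → (Fin m → Maybe X) → Maybe (Fin m → X)
  allJust zero    v = just (λ ())
  allJust (suc m) v with v zero | allJust m (λ j → v (suc j))
  ... | just x | just w = just (λ { zero → x ; (suc j) → w j })
  ... | _      | _      = nothing

  holdsP : (p : Pair) (P : PredSym τ) → (Fin (predArity P) → Elem p) → Bool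
  holdsP (n , A , α) (rel R) v = relI A R v
  holdsP (n , A , α) eq      v = ⌊ v zero ≟ v (suc zero) ⌋

  -- (A , α) ⊨ φ  (false if some variable of φ is unassigned)
  holds : Pair → Atom → Bool
  holds p (atom P ts) with allJust (predArity P) (λ j → evalTerm p (ts j))
  ... | just v  = holdsP p P v
  ... | nothing = false

  Dom : Set
  Dom = Fin k → Bool

  DomConsistent : Dom → List Pair → Set
  DomConsistent D = All (λ p → (i : Fin k) → is-just (proj₂ (proj₂ p) i) ≡ D i)

  VarsIn : Atom → Dom → Set
  VarsIn φ D = (j : Fin (predArity (pred φ))) (i : Fin k) →
               args φ j ≡ inj₁ i → D i ≡ true

  Separates : Atom → Dom → List Pair → List Pair → Set
  Separates φ D As Bs =
    VarsIn φ D × All (λ p → holds p φ ≡ true) As × All (λ p → holds p φ ≡ false) Bs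

  setVar : (i : Fin k) (p : Pair) → Elem p → Pair
  setVar i (n , A , α) a = n , A , (λ j → if ⌊ j ≟ i ⌋ then just a else α j)

  setDom : Fin k → Dom → Dom
  setDom i D j = if ⌊ j ≟ i ⌋ then true else D j

  Choice : List Pair → Set
  Choice = All Elem

  -- Duplicator's response: for each pair on her side, a nonempty list of
  -- copies, each copy given by the element assigned to x_i in it
  Response : List Pair → Set
  Response = All (λ p → List⁺ (Elem p))

  assignAll : Fin k → (As : List Pair) → Choice As → List Pair
  assignAll i []       All.[]       = []
  assignAll i (p ∷ As) (a All.∷ cs) = setVar i p a ∷ assignAll i As cs

  copyAll : Fin k → (Bs : List Pair) → Response Bs → List Pair
  copyAll i []       All.[]        = []
  copyAll i (p ∷ Bs) (as All.∷ rs) =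
    List.map (setVar i p) (List⁺.toList as) ++ copyAll i Bs rs

  Partition : List Pair → Set
  Partition = All (λ _ → Bool)

  part : Bool → (As : List Pair) → Partition As → List Pair
  part b []       All.[]       = []
  part b (p ∷ As) (c All.∷ cs) =
    if ⌊ Data.Bool._≟_ c b ⌋ then p ∷ part b As cs else part b As cs

  record Pos : Set where
    constructor pos
    field
      dom   : Dom
      left  : List Pair
      right : List Pair
      ctr   : ℕ
  open Pos public

  data Side : Set where
    L R : Side

  spSide : Side → Pos → List Pair
  spSide L p = left p
  spSide R p = right p

  dupSide : Side → Pos → List Pair
  dupSide L p = right p
  dupSide R p = left p

  hQ : Side → ℕ → ℕ
  hQ L = h∃ f
  hQ R = h∀ f

  -- A Duplicator strategy: given the history (the positions on the path
  -- from the root to the current node, most recent first), the current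
  -- node, and Spoiler's pebble move (side, variable, choices), produce
  -- her response on the other side.
  DStrategy : Set
  DStrategy = (hist : List Pos) (p : Pos) (s : Side) (i : Fin k)
              (c : Choice (spSide s p)) → Response (dupSide s p)

  pebbleChild : (p : Pos) (s : Side) (i : Fin k) →
                Choice (spSide s p) → Response (dupSide s p) → ℕ → Pos
  pebbleChild p L i c d r'' =
    pos (setDom i (dom p)) (assignAll i (left p) c) (copyAll i (right p) d) r''
  pebbleChild p R i c d r'' =
    pos (setDom i (dom p)) (copyAll i (left p) d) (assignAll i (right p) c) r''

  -- SpoilerWins σ hist p : Spoiler can play from node p (reached via hist)
  -- so that, against Duplicator strategy σ, all leaves of the subtree are
  -- eventually closed.
  data SpoilerWins (σ : DStrategy) : List Pos → Pos → Set where
    close  : ∀ {hist p} (φ : Atom) →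
             Separates φ (dom p) (left p) (right p) →
             hatom f (pred φ) ≡ ctr p →
             SpoilerWins σ hist p
    pebble : ∀ {hist p} (s : Side) (i : Fin k) (c : Choice (spSide s p))
             (r'' : ℕ) → hQ s r'' ≡ ctr p →
             SpoilerWins σ (p ∷ hist) (pebbleChild p s i c (σ hist p s i c) r'') →
             SpoilerWins σ hist p
    splitL : ∀ {hist p} (π : Partition (left p)) (r₁ r₂ : ℕ) →
             h∨ f r₁ r₂ ≡ ctr p →
             SpoilerWins σ (p ∷ hist) (pos (dom p) (part true (left p) π) (right p) r₁) →
             SpoilerWins σ (p ∷ hist) (pos (dom p) (part false (left p) π) (right p) r₂) →
             SpoilerWins σ hist p
    splitR : ∀ {hist p} (π : Partition (right p)) (r₁ r₂ : ℕ) →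
             h∧ f r₁ r₂ ≡ ctr p →
             SpoilerWins σ (p ∷ hist) (pos (dom p) (left p) (part true (right p) π) r₁) →
             SpoilerWins σ (p ∷ hist) (pos (dom p) (left p) (part false (right p) π) r₂) →
             SpoilerWins σ hist p
    swap   : ∀ {hist p} (r'' : ℕ) → h¬ f r'' ≡ ctr p →
             SpoilerWins σ (p ∷ hist) (pos (dom p) (right p) (left p) r'') →
             SpoilerWins σ hist p

  DuplicatorWinsWith : DStrategy → Dom → List Pair → List Pair → ℕ → Set
  DuplicatorWinsWith σ D As Bs r = SpoilerWins σ [] (pos D As Bs r) → Data.Empty.⊥
    where import Data.Empty

  allElems : (n : ℕ) → List⁺ (Fin (suc n))
  allElems n = zero ∷ List.map suc (allFin n)

  obliviousResp : (Bs : List Pair) → Response Bs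
  obliviousResp []       = All.[]
  obliviousResp (p ∷ Bs) = allElems (proj₁ p) All.∷ obliviousResp Bs

  oblivious : DStrategy
  oblivious hist p s i c = obliviousResp (dupSide s p)

{-# OPTIONS --safe #-}
module Submission where

-- The oblivious Duplicator answers every pebble move with all possible
-- copies, so whatever any other strategy σ answers is a subset of her answer.
-- Every Spoiler move (pebbling, splitting, swapping, closing) restricts to
-- subsets of the two sides, hence a Spoiler win against the oblivious
-- strategy yields, node by node, a Spoiler win against σ.

open import Defs
open import Data.Nat using (ℕ)
open import Data.Product using (Σ; _,_; proj₁)
open import Data.List using (List; []; _∷_)
import Data.List as List
import Data.List.NonEmpty as List⁺
open import Data.List.Relation.Unary.All using (All; _∷_; lookup)
open import Data.List.Relation.Unary.All.Properties using (anti-mono)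
open import Data.List.Relation.Unary.Any using (here; there)
open import Data.List.Membership.Propositional using (_∈_)
open import Data.List.Membership.Propositional.Properties
  using (∈-map⁺; ∈-map⁻; ∈-++⁺ˡ; ∈-++⁺ʳ; ∈-++⁻; ∈-allFin)
open import Data.List.Relation.Binary.Subset.Propositional using (_⊆_)
open import Data.List.Relation.Binary.Subset.Propositional.Properties using (⊆-refl)
open import Data.Sum using (inj₁; inj₂)
open import Data.Fin using (Fin; zero; suc)
open import Data.Bool using (Bool; true; false)
import Data.Bool as Bool
open import Data.Empty using (⊥-elim)
open import Relation.Nullary using (yes; no)
open import Relation.Binary.PropositionalEquality using (_≡_; refl)

module _ (τ : Sig) (k : ℕ) (f : CSM τ) where
  open Game τ k f

  drop-∷ : ∀ {x : Pair} {X Y : List Pair} → x ∷ X ⊆ Y → X ⊆ Y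
  drop-∷ s m = s (there m)

  ∈-part : (b : Bool) {A : List Pair} (π : Partition A) {x : Pair} (m : x ∈ A) →
           lookup π m ≡ b → x ∈ part b A π
  ∈-part b (c ∷ π) (here refl) c≡b with Bool._≟_ c b
  ... | yes _  = here refl
  ... | no c≢b = ⊥-elim (c≢b c≡b)
  ∈-part b (c ∷ π) (there m) c≡b with Bool._≟_ c b
  ... | yes _ = there (∈-part b π m c≡b)
  ... | no _  = ∈-part b π m c≡b

  part-anti-mono : (b : Bool) {A : List Pair} (π : Partition A) (A' : List Pair)
                   (s : A' ⊆ A) → part b A' (anti-mono s π) ⊆ part b A π
  part-anti-mono b π (x ∷ A') s m with Bool._≟_ (lookup π (s (here refl))) b
  part-anti-mono b π (x ∷ A') s (here refl) | yes e = ∈-part b π (s (here refl)) e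
  part-anti-mono b π (x ∷ A') s (there m)   | yes _ = part-anti-mono b π A' (drop-∷ s) m
  ... | no _ = part-anti-mono b π A' (drop-∷ s) m

  ∈-assignAll : (i : Fin k) {A : List Pair} (c : Choice A) {x : Pair} (m : x ∈ A) →
                setVar i x (lookup c m) ∈ assignAll i A c
  ∈-assignAll i (a ∷ c) (here refl) = here refl
  ∈-assignAll i (a ∷ c) (there m)   = there (∈-assignAll i c m)

  assignAll-anti-mono : (i : Fin k) {A : List Pair} (c : Choice A) (A' : List Pair)
                        (s : A' ⊆ A) → assignAll i A' (anti-mono s c) ⊆ assignAll i A c
  assignAll-anti-mono i c (x ∷ A') s (here refl) = ∈-assignAll i c (s (here refl))
  assignAll-anti-mono i c (x ∷ A') s (there m)   = assignAll-anti-mono i c A' (drop-∷ s) m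

  ∈-allElems : (n : ℕ) (a : Fin (ℕ.suc n)) → a ∈ List⁺.toList (allElems n)
  ∈-allElems n zero    = here refl
  ∈-allElems n (suc a) = there (∈-map⁺ suc (∈-allFin a))

  ∈-copyAll-oblivious : (i : Fin k) {B : List Pair} {b : Pair} → b ∈ B → (a : Elem b) →
                        setVar i b a ∈ copyAll i B (obliviousResp B)
  ∈-copyAll-oblivious i {b ∷ _} (here refl) a =
    ∈-++⁺ˡ (∈-map⁺ (setVar i b) (∈-allElems (proj₁ b) a))
  ∈-copyAll-oblivious i (there m) a = ∈-++⁺ʳ _ (∈-copyAll-oblivious i m a)

  copyAll⊆copyAll-oblivious : (i : Fin k) {B : List Pair} (B' : List Pair) → B' ⊆ B →
                              (d : Response B') → copyAll i B' d ⊆ copyAll i B (obliviousResp B)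
  copyAll⊆copyAll-oblivious i (b ∷ B') s (as ∷ d) m
    with ∈-++⁻ (List.map (setVar i b) (List⁺.toList as)) m
  ... | inj₂ m' = copyAll⊆copyAll-oblivious i B' (drop-∷ s) d m'
  ... | inj₁ m' with ∈-map⁻ (setVar i b) m'
  ...   | a , _ , refl = ∈-copyAll-oblivious i (s (here refl)) a

  -- σ sees its own history h', which is unrelated to the history h of the
  -- oblivious play; this is harmless because the oblivious strategy ignores it.
  beatsOblivious⇒beatsOnSubsets :
    (σ : DStrategy) {h : List Pos} {p : Pos} → SpoilerWins oblivious h p →
    (h' : List Pos) (A' B' : List Pair) → A' ⊆ left p → B' ⊆ right p →
    SpoilerWins σ h' (pos (dom p) A' B' (ctr p))
  beatsOblivious⇒beatsOnSubsets σ (close φ (vars , holdsA , failsB) e) h' A' B' sa sb =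
    close φ (vars , anti-mono sa holdsA , anti-mono sb failsB) e
  beatsOblivious⇒beatsOnSubsets σ {p = p} (pebble L i c r'' e w) h' A' B' sa sb =
    pebble L i c' r'' e
      (beatsOblivious⇒beatsOnSubsets σ w (q ∷ h') _ _
        (assignAll-anti-mono i c A' sa)
        (copyAll⊆copyAll-oblivious i B' sb (σ h' q L i c')))
    where q = pos (dom p) A' B' (ctr p)
          c' = anti-mono sa c
  beatsOblivious⇒beatsOnSubsets σ {p = p} (pebble R i c r'' e w) h' A' B' sa sb =
    pebble R i c' r'' e
      (beatsOblivious⇒beatsOnSubsets σ w (q ∷ h') _ _
        (copyAll⊆copyAll-oblivious i A' sa (σ h' q R i c'))
        (assignAll-anti-mono i c B' sb))
    where q = pos (dom p) A' B' (ctr p)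
          c' = anti-mono sb c
  beatsOblivious⇒beatsOnSubsets σ {p = p} (splitL π r₁ r₂ e w₁ w₂) h' A' B' sa sb =
    splitL (anti-mono sa π) r₁ r₂ e
      (beatsOblivious⇒beatsOnSubsets σ w₁ (q ∷ h') _ _ (part-anti-mono true π A' sa) sb)
      (beatsOblivious⇒beatsOnSubsets σ w₂ (q ∷ h') _ _ (part-anti-mono false π A' sa) sb)
    where q = pos (dom p) A' B' (ctr p)
  beatsOblivious⇒beatsOnSubsets σ {p = p} (splitR π r₁ r₂ e w₁ w₂) h' A' B' sa sb =
    splitR (anti-mono sb π) r₁ r₂ e
      (beatsOblivious⇒beatsOnSubsets σ w₁ (q ∷ h') _ _ sa (part-anti-mono true π B' sb))
      (beatsOblivious⇒beatsOnSubsets σ w₂ (q ∷ h') _ _ sa (part-anti-mono false π B' sb))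
    where q = pos (dom p) A' B' (ctr p)
  beatsOblivious⇒beatsOnSubsets σ {p = p} (swap r'' e w) h' A' B' sa sb =
    swap r'' e (beatsOblivious⇒beatsOnSubsets σ w (pos (dom p) A' B' (ctr p) ∷ h') B' A' sb sa)

proposition6p9 : (τ : Sig) (k : ℕ) (f : CSM τ) (r : ℕ) (D : Game.Dom τ k f)
    (As Bs : List (Game.Pair τ k f)) →
    Game.DomConsistent τ k f D As → Game.DomConsistent τ k f D Bs →
    Σ (Game.DStrategy τ k f) (λ σ → Game.DuplicatorWinsWith τ k f σ D As Bs r) →
    Game.DuplicatorWinsWith τ k f (Game.oblivious τ k f) D As Bs r
proposition6p9 τ k f r D As Bs _ _ (σ , σ-wins) spoiler-beats-oblivious =
  σ-wins (beatsOblivious⇒beatsOnSubsets τ k f σ spoiler-beats-oblivious [] As Bs ⊆-refl ⊆-refl)
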